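{- Let $G$ be a spider with spider partition $(I,K,R)$ which is not a cograph. Then $\operatorname{car}(G)\leq 2$.
   Context: All graphs are finite, simple and undirected; $G[X]$ denotes the subgraph induced by $X$. A cograph is a graph with no induced path on four vertices. A spider is a graph whose vertex set is partitioned into $I=\{s_1,\dots,s_k\}$ ($k\geq 2$), an independent set, $K=\{k_1,\dots,k_k\}$, a clique, and $R$ (possibly empty), such that either $s_i$ is adjacent to $k_j$ iff $i=j$ (thin spider) or $s_i$ is adjacent to $k_j$ iff $i\neq j$ (thick spider), and every vertex of $R$ is adjacent to all vertices of $K$ and to no vertex of $I$. A set $S\subseteq V(G)$ is cycle convex if for every $u\in V(G)\setminus S$ the graph $G[S\cup\{u\}]$ contains no cycle passing through $u$. The cycle convex hull $\langle S\rangle$ is the smallest cycle convex set containing $S$. A set $S$ is Carathéodory independent if there is $p\in\langle S\rangle$ with $p\notin \bigcup_{a\in S}\langle S\setminus\{a\}\rangle$. The Carathéodory number $\operatorname{car}(G)$ is the maximum cardinality of a Carathéodory independent set of $G$. -}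

module Defs where

open import Data.Nat using (ℕ; _≤_)
open import Data.Fin using (Fin)
open import Data.Fin.Subset using (Subset; _∈_; _∉_; _⊆_; _∪_; ⁅_⁆; _-_; ∣_∣)
open import Data.Bool using (Bool; true; false)
open import Data.List using (List; []; _∷_; _++_; [_]; length)
open import Data.List.Relation.Unary.All using (All)
open import Data.List.Relation.Unary.Unique.Propositional using (Unique)
open import Data.List.Relation.Unary.Linked using (Linked)
open import Data.Product using (Σ; ∃; _×_)
open import Data.Sum using (_⊎_)
open import Relation.Binary.PropositionalEquality using (_≡_; _≢_)
open import Relation.Nullary using (¬_)
open import Function.Definitions using (Injective)

record Graph (n : ℕ) : Set where
  field
    adj     : Fin n → Fin n → Bool
    symm    : ∀ x y → adj x y ≡ adj y x
    irrefl  : ∀ x → adj x x ≡ false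

module _ {n : ℕ} (G : Graph n) where
  open Graph G

  E : Fin n → Fin n → Set
  E x y = adj x y ≡ true

  CycleThrough : Subset n → Fin n → Set
  CycleThrough X u =
    Σ (List (Fin n)) λ vs →
      (2 ≤ length vs) × u ∈ X × All (_∈ X) vs × Unique (u ∷ vs)
      × Linked E (u ∷ vs ++ [ u ])

  CycleConvex : Subset n → Set
  CycleConvex S = ∀ u → u ∉ S → ¬ CycleThrough (S ∪ ⁅ u ⁆) u

  -- p ∈ ⟨S⟩ : p lies in every cycle convex set containing S
  -- (the cycle convex hull, i.e. the smallest cycle convex superset of S,
  --  is the intersection of all cycle convex supersets of S).
  InHull : Subset n → Fin n → Set
  InHull S p = ∀ T → S ⊆ T → CycleConvex T → p ∈ T

  CaratheodoryIndependent : Subset n → Set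
  CaratheodoryIndependent S =
    ∃ λ p → InHull S p × (∀ a → a ∈ S → ¬ InHull (S - a) p)

  CarAtMost : ℕ → Set
  CarAtMost m = ∀ S → CaratheodoryIndependent S → ∣ S ∣ ≤ m

  InducedP4 : Fin n → Fin n → Fin n → Fin n → Set
  InducedP4 a b c d =
    E a b × E b c × E c d × ¬ E a c × ¬ E b d × ¬ E a d

  IsCograph : Set
  IsCograph = ∀ a b c d → ¬ InducedP4 a b c d

  -- Spider partition (I, K, R): I = {s i}, K = {c i} (i : Fin k), k ≥ 2,
  -- R = all remaining vertices.
  record SpiderPartition : Set where
    field
      k        : ℕ
      2≤k      : 2 ≤ k
      s        : Fin k → Fin n
      c        : Fin k → Fin n
      s-inj    : Injective _≡_ _≡_ s
      c-inj    : Injective _≡_ _≡_ c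
      s≢c      : ∀ i j → s i ≢ c j
      I-indep  : ∀ i j → ¬ E (s i) (s j)
      K-clique : ∀ i j → i ≢ j → E (c i) (c j)
      legs     : (∀ i j → (E (s i) (c j) → i ≡ j) × (i ≡ j → E (s i) (c j)))
               ⊎ (∀ i j → (E (s i) (c j) → i ≢ j) × (i ≢ j → E (s i) (c j)))
      R-adj    : ∀ v → (∀ i → v ≢ s i) → (∀ i → v ≢ c i) →
                 (∀ j → E v (c j)) × (∀ i → ¬ E v (s i))

  IsSpider : Set
  IsSpider = SpiderPartition

-- A cycle through a vertex u outside S ∪ {u} starts with an edge of S whose endpoints
-- both have two distinct neighbours ("branching" vertices), and u itself is branching.
-- In a spider, a cycle convex set containing such a branching edge is forced, through
-- triangles, to contain two vertices of the clique K, hence all of K ∪ R and every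
-- branching leg. So if p ∈ ⟨S⟩ ∖ S then S has a branching edge xy, p is branching, and
-- any third element a of S can be dropped: ⟨S - a⟩ still contains x, y and hence p.
module Submission where

open import Defs
open import Data.Nat using (ℕ; _≤_; _<_; z≤n; s≤s; _+_; _≤?_)
open import Data.Nat.Properties using (≤-trans; ≤-reflexive; n≤1+n; +-monoʳ-≤; +-suc; <⇒≱; ≰⇒>)
open import Data.Fin using (Fin; zero; suc; _≟_)
open import Data.Fin.Properties using (any?)
open import Data.Fin.Subset using (Subset; _∈_; _∉_; _⊆_; _∪_; ⁅_⁆; ∣_∣; ∁)
open import Data.Fin.Subset.Properties
  using (_∈?_; x∈p∪q⁻; x∈p∪q⁺; x∈⁅x⁆; x∈⁅y⁆⇒x≡y; x≢y⇒x∉⁅y⁆; ∣⁅x⁆∣≡1; p⊆q⇒∣p∣≤∣q∣;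
         x∈p∧x≢y⇒x∈p-y; x∉p⇒x∈∁p; x∈∁p⇒x∉p; x∉∁p⇒x∈p)
open import Data.Bool using (true; false)
import Data.Bool as Bool
open import Data.Vec using ([]; _∷_)
open import Data.List using (List; []; _∷_; _++_; [_])
open import Data.List.Relation.Unary.All using (All; []; _∷_)
open import Data.List.Relation.Unary.AllPairs using ([]; _∷_)
open import Data.List.Relation.Unary.Linked using (Linked; [-]; _∷_)
open import Data.Product using (∃; ∃₂; _×_; _,_; proj₁; proj₂)
open import Data.Sum using (inj₁; inj₂)
open import Data.Empty using (⊥; ⊥-elim)
open import Relation.Nullary using (¬_; Dec; yes; no)
open import Relation.Nullary.Decidable using (_×-dec_; ¬?)
open import Relation.Binary.PropositionalEquality using (_≡_; _≢_; refl; sym; trans; cong₂; ≢-sym)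
open import Function using (id)

∣p∪q∣≤∣p∣+∣q∣ : ∀ {n} (p q : Subset n) → ∣ p ∪ q ∣ ≤ ∣ p ∣ + ∣ q ∣
∣p∪q∣≤∣p∣+∣q∣ []          []          = z≤n
∣p∪q∣≤∣p∣+∣q∣ (true  ∷ p) (true  ∷ q) =
  s≤s (≤-trans (∣p∪q∣≤∣p∣+∣q∣ p q) (+-monoʳ-≤ ∣ p ∣ (n≤1+n ∣ q ∣)))
∣p∪q∣≤∣p∣+∣q∣ (true  ∷ p) (false ∷ q) = s≤s (∣p∪q∣≤∣p∣+∣q∣ p q)
∣p∪q∣≤∣p∣+∣q∣ (false ∷ p) (true  ∷ q) rewrite +-suc ∣ p ∣ ∣ q ∣ = s≤s (∣p∪q∣≤∣p∣+∣q∣ p q)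
∣p∪q∣≤∣p∣+∣q∣ (false ∷ p) (false ∷ q) = ∣p∪q∣≤∣p∣+∣q∣ p q

2<∣p∣⇒∃∈p-x-y : ∀ {n} {p : Subset n} → 2 < ∣ p ∣ → ∀ x y → ∃ λ a → a ∈ p × a ≢ x × a ≢ y
2<∣p∣⇒∃∈p-x-y {p = p} 2<∣p∣ x y with any? (λ a → a ∈? p ×-dec ¬? (a ≟ x) ×-dec ¬? (a ≟ y))
... | yes found = found
... | no none   = ⊥-elim (<⇒≱ 2<∣p∣ ∣p∣≤2)
  where
  p⊆⁅x⁆∪⁅y⁆ : p ⊆ ⁅ x ⁆ ∪ ⁅ y ⁆
  p⊆⁅x⁆∪⁅y⁆ {a} a∈p with a ≟ x | a ≟ y
  ... | yes refl | _        = x∈p∪q⁺ (inj₁ (x∈⁅x⁆ a))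
  ... | no _     | yes refl = x∈p∪q⁺ {p = ⁅ x ⁆} (inj₂ (x∈⁅x⁆ a))
  ... | no a≢x   | no a≢y   = ⊥-elim (none (a , a∈p , a≢x , a≢y))

  ∣p∣≤2 : ∣ p ∣ ≤ 2
  ∣p∣≤2 = ≤-trans (p⊆q⇒∣p∣≤∣q∣ p⊆⁅x⁆∪⁅y⁆)
            (≤-trans (∣p∪q∣≤∣p∣+∣q∣ ⁅ x ⁆ ⁅ y ⁆)
              (≤-reflexive (cong₂ _+_ (∣⁅x⁆∣≡1 x) (∣⁅x⁆∣≡1 y))))

Linked-last : ∀ {A : Set} {R : A → A → Set} {P : A → Set} {y z : A} (ys : List A) →
              Linked R (y ∷ ys ++ [ z ]) → All P (y ∷ ys) → ∃ λ w → P w × R w z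
Linked-last []       (r ∷ [-]) (py ∷ []) = _ , py , r
Linked-last (_ ∷ ys) (_ ∷ l)   (_ ∷ ps)  = Linked-last ys l ps

module GraphProperties {n : ℕ} (G : Graph n) where

  E-sym : ∀ {x y} → E G x y → E G y x
  E-sym {x} {y} xy = trans (Graph.symm G y x) xy

  E⇒≢ : ∀ {x y} → E G x y → x ≢ y
  E⇒≢ {x} loop refl with trans (sym loop) (Graph.irrefl G x)
  ... | ()

  E? : ∀ x y → Dec (E G x y)
  E? x y = Graph.adj G x y Bool.≟ true

  Branching : Fin n → Set
  Branching x = ∃₂ λ w₁ w₂ → E G x w₁ × E G x w₂ × w₁ ≢ w₂

  branching? : ∀ x → Dec (Branching x)
  branching? x = any? λ w₁ → any? λ w₂ → E? x w₁ ×-dec E? x w₂ ×-dec ¬? (w₁ ≟ w₂)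

  branching⇒otherNeighbour : ∀ {x} → Branching x → ∀ y → ∃ λ w → E G x w × w ≢ y
  branching⇒otherNeighbour (w₁ , w₂ , xw₁ , xw₂ , w₁≢w₂) y with w₁ ≟ y
  ... | no  w₁≢y = w₁ , xw₁ , w₁≢y
  ... | yes refl = w₂ , xw₂ , ≢-sym w₁≢w₂

  BranchingEdge : Subset n → Set
  BranchingEdge S = ∃₂ λ x y → x ∈ S × y ∈ S × E G x y × Branching x × Branching y

  branchingEdge? : ∀ S → Dec (BranchingEdge S)
  branchingEdge? S = any? λ x → any? λ y →
    x ∈? S ×-dec y ∈? S ×-dec E? x y ×-dec branching? x ×-dec branching? y

  cycleThrough⇒branching : ∀ {X u} → CycleThrough G X u → Branching u
  cycleThrough⇒branching
    (v₁ ∷ v₂ ∷ vs , _ , _ , _ , _ ∷ ((v₁≢v₂ ∷ v₁≢vs) ∷ _) , uv₁ ∷ v₁v₂ ∷ path)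
    with Linked-last vs path (v₁≢v₂ ∷ v₁≢vs)
  ... | w , v₁≢w , wu = v₁ , w , uv₁ , E-sym wu , v₁≢w
  cycleThrough⇒branching (_ ∷ [] , s≤s () , _)

  cycleThrough⇒branchingEdge : ∀ {S u} → CycleThrough G (S ∪ ⁅ u ⁆) u → BranchingEdge S
  cycleThrough⇒branchingEdge {S} {u}
    (v₁ ∷ v₂ ∷ vs , _ , _ , v₁∈ ∷ v₂∈ ∷ _ , (u≢v₁ ∷ u≢v₂ ∷ _) ∷ ((_ ∷ v₁≢vs) ∷ _) ,
     uv₁ ∷ v₁v₂ ∷ path) =
    v₁ , v₂ , inS v₁∈ u≢v₁ , inS v₂∈ u≢v₂ , v₁v₂ ,
    (u , v₂ , E-sym uv₁ , v₁v₂ , u≢v₂) , v₂-branching vs path v₁≢vs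
    where
    inS : ∀ {v} → v ∈ S ∪ ⁅ u ⁆ → u ≢ v → v ∈ S
    inS {v} v∈ u≢v with x∈p∪q⁻ S ⁅ u ⁆ v∈
    ... | inj₁ v∈S = v∈S
    ... | inj₂ v∈u = ⊥-elim (u≢v (sym (x∈⁅y⁆⇒x≡y u v∈u)))

    v₂-branching : ∀ vs → Linked (E G) (v₂ ∷ vs ++ [ u ]) → All (v₁ ≢_) vs → Branching v₂
    v₂-branching []       (v₂u ∷ [-]) _            = v₁ , u , E-sym v₁v₂ , v₂u , ≢-sym u≢v₁
    v₂-branching (v₃ ∷ _) (v₂v₃ ∷ _)  (v₁≢v₃ ∷ _) = v₁ , v₃ , E-sym v₁v₂ , v₂v₃ , v₁≢v₃
  cycleThrough⇒branchingEdge (_ ∷ [] , s≤s () , _)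

  noBranchingEdge⇒convex : ∀ {S} → ¬ BranchingEdge S → CycleConvex G S
  noBranchingEdge⇒convex ¬edge u _ cycle = ¬edge (cycleThrough⇒branchingEdge cycle)

  inHull-∉⇒branching : ∀ {S p} → InHull G S p → p ∉ S → Branching p
  inHull-∉⇒branching {S} {p} p∈⟨S⟩ p∉S with branching? p
  ... | yes branching = branching
  ... | no ¬branching = ⊥-elim (x∈∁p⇒x∉p (p∈⟨S⟩ (∁ ⁅ p ⁆) S⊆∁⁅p⁆ ∁⁅p⁆-convex) (x∈⁅x⁆ p))
    where
    S⊆∁⁅p⁆ : S ⊆ ∁ ⁅ p ⁆
    S⊆∁⁅p⁆ {x} x∈S = x∉p⇒x∈∁p (x≢y⇒x∉⁅y⁆ λ { refl → p∉S x∈S })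

    ∁⁅p⁆-convex : CycleConvex G (∁ ⁅ p ⁆)
    ∁⁅p⁆-convex u u∉ cycle with x∈⁅y⁆⇒x≡y p (x∉∁p⇒x∈p u∉)
    ... | refl = ¬branching (cycleThrough⇒branching cycle)

  convex⇒commonNeighbour∈ : ∀ {T x y z} → CycleConvex G T → x ∈ T → y ∈ T →
                            E G x y → E G z x → E G z y → z ∈ T
  convex⇒commonNeighbour∈ {T} {x} {y} {z} convex x∈T y∈T xy zx zy with z ∈? T
  ... | yes z∈T = z∈T
  ... | no  z∉T = ⊥-elim (convex z z∉T triangle)
    where
    triangle : CycleThrough G (T ∪ ⁅ z ⁆) z
    triangle = x ∷ y ∷ [] , s≤s (s≤s z≤n) , x∈p∪q⁺ {p = T} (inj₂ (x∈⁅x⁆ z))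
             , x∈p∪q⁺ (inj₁ x∈T) ∷ x∈p∪q⁺ (inj₁ y∈T) ∷ []
             , (E⇒≢ zx ∷ E⇒≢ zy ∷ []) ∷ (E⇒≢ xy ∷ []) ∷ [] ∷ []
             , zx ∷ xy ∷ E-sym zy ∷ [-]

  BranchingEdgesSpan : Set
  BranchingEdgesSpan = ∀ T → CycleConvex G T → BranchingEdge T → ∀ v → Branching v → v ∈ T

  branchingEdgesSpan⇒car≤2 : BranchingEdgesSpan → CarAtMost G 2
  branchingEdgesSpan⇒car≤2 span S (p , p∈⟨S⟩ , p∉⟨S-a⟩) with ∣ S ∣ ≤? 2
  ... | yes ∣S∣≤2 = ∣S∣≤2
  ... | no  ∣S∣≰2 = ⊥-elim contradiction
    where
    third : ∀ x y → ∃ λ a → a ∈ S × a ≢ x × a ≢ y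
    third = 2<∣p∣⇒∃∈p-x-y (≰⇒> ∣S∣≰2)

    contradiction : ⊥
    contradiction with p ∈? S
    ... | yes p∈S with third p p
    ... | a , a∈S , a≢p , _ =
      p∉⟨S-a⟩ a a∈S λ _ S-a⊆T _ → S-a⊆T (x∈p∧x≢y⇒x∈p-y p∈S (≢-sym a≢p))
    contradiction | no p∉S with branchingEdge? S
    ... | no ¬edge = p∉S (p∈⟨S⟩ S id (noBranchingEdge⇒convex ¬edge))
    ... | yes (x , y , x∈S , y∈S , xy , x-branching , y-branching) with third x y
    ... | a , a∈S , a≢x , a≢y = p∉⟨S-a⟩ a a∈S λ T S-a⊆T T-convex →
      span T T-convex
        ( x , y , S-a⊆T (x∈p∧x≢y⇒x∈p-y x∈S (≢-sym a≢x)) , S-a⊆T (x∈p∧x≢y⇒x∈p-y y∈S (≢-sym a≢y))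
        , xy , x-branching , y-branching)
        p (inHull-∉⇒branching p∈⟨S⟩ p∉S)

anotherIndex : ∀ {k} → 2 ≤ k → (i : Fin k) → ∃ λ j → j ≢ i
anotherIndex (s≤s (s≤s _)) zero    = suc zero , λ ()
anotherIndex (s≤s (s≤s _)) (suc _) = zero , λ ()

twoIndices : ∀ {k} → 2 ≤ k → ∃₂ λ (i j : Fin k) → i ≢ j
twoIndices (s≤s (s≤s _)) = zero , suc zero , λ ()

module SpiderProperties {n : ℕ} (G : Graph n) (spider : SpiderPartition G) where
  open SpiderPartition spider
  open GraphProperties G

  data Part (v : Fin n) : Set where
    leg  : ∀ i → v ≡ s i → Part v
    body : ∀ i → v ≡ c i → Part v
    rest : (∀ i → v ≢ s i) → (∀ i → v ≢ c i) → Part v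

  part : ∀ v → Part v
  part v with any? (λ i → v ≟ s i) | any? (λ i → v ≟ c i)
  ... | yes (i , v≡sᵢ) | _              = leg i v≡sᵢ
  ... | no _           | yes (i , v≡cᵢ) = body i v≡cᵢ
  ... | no ¬leg        | no ¬body       = rest (λ i v≡sᵢ → ¬leg (i , v≡sᵢ)) (λ i v≡cᵢ → ¬body (i , v≡cᵢ))

  legNeighbour∈K : ∀ {i w} → E G (s i) w → ∃ λ j → w ≡ c j
  legNeighbour∈K {i} {w} sᵢw with part w
  ... | leg j refl      = ⊥-elim (I-indep i j sᵢw)
  ... | body j w≡cⱼ     = j , w≡cⱼ
  ... | rest ¬leg ¬body = ⊥-elim (proj₂ (R-adj w ¬leg ¬body) i (E-sym sᵢw))

  TwoOfK : Subset n → Set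
  TwoOfK T = ∃₂ λ i j → i ≢ j × c i ∈ T × c j ∈ T

  module _ {T : Subset n} (convex : CycleConvex G T) where

    twoOfK⇒K⊆ : TwoOfK T → ∀ l → c l ∈ T
    twoOfK⇒K⊆ (i , j , i≢j , cᵢ∈T , cⱼ∈T) l with l ≟ i | l ≟ j
    ... | yes refl | _        = cᵢ∈T
    ... | no _     | yes refl = cⱼ∈T
    ... | no l≢i   | no l≢j   =
      convex⇒commonNeighbour∈ convex cᵢ∈T cⱼ∈T (K-clique i j i≢j) (K-clique l i l≢i) (K-clique l j l≢j)

    twoOfK⇒R⊆ : TwoOfK T → ∀ v → (∀ i → v ≢ s i) → (∀ i → v ≢ c i) → v ∈ T
    twoOfK⇒R⊆ (i , j , i≢j , cᵢ∈T , cⱼ∈T) v ¬leg ¬body =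
      convex⇒commonNeighbour∈ convex cᵢ∈T cⱼ∈T (K-clique i j i≢j)
        (proj₁ (R-adj v ¬leg ¬body) i) (proj₁ (R-adj v ¬leg ¬body) j)

    twoOfK⇒branching⊆ : TwoOfK T → ∀ v → Branching v → v ∈ T
    twoOfK⇒branching⊆ two v branching with part v
    ... | body l refl     = twoOfK⇒K⊆ two l
    ... | rest ¬leg ¬body = twoOfK⇒R⊆ two v ¬leg ¬body
    ... | leg i refl with branching
    ... | w₁ , w₂ , sᵢw₁ , sᵢw₂ , w₁≢w₂ with legNeighbour∈K sᵢw₁ | legNeighbour∈K sᵢw₂
    ... | j₁ , refl | j₂ , refl =
      convex⇒commonNeighbour∈ convex (twoOfK⇒K⊆ two j₁) (twoOfK⇒K⊆ two j₂)
        (K-clique j₁ j₂ λ { refl → w₁≢w₂ refl }) sᵢw₁ sᵢw₂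

    bodyRestEdge⇒twoOfK : ∀ {i y} → c i ∈ T → y ∈ T → E G (c i) y →
                          (∀ l → y ≢ s l) → (∀ l → y ≢ c l) → TwoOfK T
    bodyRestEdge⇒twoOfK {i} {y} cᵢ∈T y∈T cᵢy ¬leg ¬body with anotherIndex 2≤k i
    ... | j , j≢i = i , j , ≢-sym j≢i , cᵢ∈T ,
      convex⇒commonNeighbour∈ convex cᵢ∈T y∈T cᵢy (K-clique j i j≢i) (E-sym (proj₁ (R-adj y ¬leg ¬body) j))

    -- A branching leg sᵢ has a second neighbour cₗ besides its neighbour cⱼ in T,
    -- and the triangle sᵢ cⱼ cₗ puts cₗ into T.
    branchingLegEdge⇒twoOfK : ∀ {i y} → s i ∈ T → y ∈ T → E G (s i) y → Branching (s i) → TwoOfK T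
    branchingLegEdge⇒twoOfK {i} sᵢ∈T y∈T sᵢy branching with legNeighbour∈K sᵢy
    ... | j , refl with branching⇒otherNeighbour branching (c j)
    ... | w , sᵢw , w≢cⱼ with legNeighbour∈K sᵢw
    ... | l , refl = j , l , (λ { refl → w≢cⱼ refl }) , y∈T ,
      convex⇒commonNeighbour∈ convex sᵢ∈T y∈T sᵢy (E-sym sᵢw) (K-clique l j λ { refl → w≢cⱼ refl })

    branchingEdge⇒twoOfK : BranchingEdge T → TwoOfK T
    branchingEdge⇒twoOfK (x , y , x∈T , y∈T , xy , x-branching , y-branching) with part x | part y
    ... | leg i refl | _ = branchingLegEdge⇒twoOfK x∈T y∈T xy x-branching
    ... | _ | leg j refl = branchingLegEdge⇒twoOfK y∈T x∈T (E-sym xy) y-branching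
    ... | body i refl | body j refl = i , j , (λ { refl → E⇒≢ xy refl }) , x∈T , y∈T
    ... | body i refl | rest ¬leg ¬body = bodyRestEdge⇒twoOfK x∈T y∈T xy ¬leg ¬body
    ... | rest ¬leg ¬body | body j refl = bodyRestEdge⇒twoOfK y∈T x∈T (E-sym xy) ¬leg ¬body
    ... | rest ¬legx ¬bodyx | rest ¬legy ¬bodyy with twoIndices 2≤k
    ... | i , j , i≢j = i , j , i≢j , commonKNeighbour∈ i , commonKNeighbour∈ j
      where
      commonKNeighbour∈ : ∀ l → c l ∈ T
      commonKNeighbour∈ l = convex⇒commonNeighbour∈ convex x∈T y∈T xy
        (E-sym (proj₁ (R-adj x ¬legx ¬bodyx) l)) (E-sym (proj₁ (R-adj y ¬legy ¬bodyy) l))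

  branchingEdgesSpan : BranchingEdgesSpan
  branchingEdgesSpan T convex edge = twoOfK⇒branching⊆ convex (branchingEdge⇒twoOfK convex edge)

-- The bound holds for every spider.
lemma4p5 : ∀ {n : ℕ} (G : Graph n) → SpiderPartition G → ¬ IsCograph G → CarAtMost G 2
lemma4p5 G spider _ =
  GraphProperties.branchingEdgesSpan⇒car≤2 G (SpiderProperties.branchingEdgesSpan G spider)
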